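{- Let $G$ be a labeled graph with a $12$-representant $w$, and suppose a letter $i$ occurs exactly twice in $w$. (a) If $w=W_1\, i\, j\, W_2\, i\, W_3$ for subwords $W_1,W_2,W_3$ and a letter $j$ with $j<i$, then $w'=W_1\, j\, i\, W_2\, i\, W_3$ is a $12$-representant of $G$. (b) If $w=W_1\, i\, W_2\, j\, i\, W_3$ for subwords $W_1,W_2,W_3$ and a letter $j$ with $j>i$, then $w'=W_1\, i\, W_2\, i\, j\, W_3$ is a $12$-representant of $G$. (c) If $w=W_1\, i\, i\, W_2$ for subwords $W_1,W_2$, then $w'=W_1\, i\, W_2$ is a $12$-representant of $G$.
   Context: A labeled graph on $n$ vertices has its vertices labeled by distinct integers from $[n]=\{1,\dots,n\}$; vertices are identified with their labels. A word $w$ over $[n]$ is a $12$-representant of $G$ if every letter of $[n]$ occurs at least once in $w$ and, for all $i<j$, the vertices $i$ and $j$ are adjacent in $G$ if and only if there is no occurrence of $i$ in $w$ that precedes an occurrence of $j$. -}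

module Defs where

open import Data.Nat using (ℕ)
open import Data.Fin using (Fin; _<_)
open import Data.Fin.Properties using (_≟_)
open import Data.List using (List; _∷_; []; _++_; length; filter)
open import Data.List.Membership.Propositional using (_∈_)
open import Data.Product using (∃; ∃₂; _×_; _,_)
open import Relation.Binary.PropositionalEquality using (_≡_)
open import Relation.Nullary using (¬_)
open import Function.Bundles using (_⇔_)

-- A labeled (simple) graph on n vertices; vertices are identified with
-- their labels, represented as Fin n (label k+1 ↔ Fin element k; the
-- order on Fin agrees with the order on labels).
record Graph (n : ℕ) : Set₁ where
  field
    Adj     : Fin n → Fin n → Set
    sym     : ∀ {i j} → Adj i j → Adj j i
    irrefl  : ∀ {i} → ¬ Adj i i

open Graph public

Word : ℕ → Set
Word n = List (Fin n)

Precedes : ∀ {n} → Word n → Fin n → Fin n → Set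
Precedes w i j = ∃₂ λ u v → (w ≡ u ++ (i ∷ v)) × (j ∈ v)

occ : ∀ {n} → Fin n → Word n → ℕ
occ i w = length (filter (_≟ i) w)

Is12Rep : ∀ {n} → Graph n → Word n → Set
Is12Rep {n} G w =
  (∀ (k : Fin n) → k ∈ w) ×
  (∀ (i j : Fin n) → i < j → (Adj G i j ⇔ (¬ Precedes w i j)))

-- Adjacency of a pair a < b only depends on whether a occurs before b somewhere
-- in the word, so it suffices to check that each rewrite preserves that relation
-- for every such pair.  Swapping two adjacent letters can only change whether the
-- first precedes the second; in (a) and (b) that pair is (larger , smaller), which
-- never matters, while the reversed pair stays witnessed by the other occurrence
-- of i (the later one in (a), the earlier one in (b)).  In (c) only the pair
-- (i , i) is affected.
module Submission where

open import Defs
open import Data.Nat using (ℕ)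
open import Data.Fin using (Fin; _<_; _>_)
open import Data.Fin.Properties using (<-irrefl; <-asym)
open import Data.List using (_∷_; _++_; [])
open import Data.List.Properties using (++-assoc)
open import Data.List.Membership.Propositional using (_∈_)
open import Data.List.Membership.Propositional.Properties using (∈-++⁺ˡ; ∈-++⁺ʳ; ∈-++⁻; ∈-∃++)
open import Data.List.Relation.Unary.Any using (here; there)
open import Data.List.Relation.Binary.Permutation.Propositional using (↭-refl; swap)
open import Data.List.Relation.Binary.Permutation.Propositional.Properties using (∈-resp-↭)
open import Data.Product using (_×_; _,_)
open import Data.Sum using (_⊎_; inj₁; inj₂)
open import Data.Empty using (⊥-elim)
open import Relation.Binary.PropositionalEquality as ≡ using (_≡_; refl; subst)
open import Relation.Nullary using (¬_)
open import Function.Bundles using (_⇔_; mk⇔; Equivalence)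

module _ {n : ℕ} where

  Precedes-head : ∀ {w : Word n} {a b} → b ∈ w → Precedes (a ∷ w) a b
  Precedes-head {w} b∈w = [] , w , refl , b∈w

  Precedes-∷⁺ : ∀ {x : Fin n} {w a b} → Precedes w a b → Precedes (x ∷ w) a b
  Precedes-∷⁺ {x} (u , v , refl , b∈v) = x ∷ u , v , refl , b∈v

  Precedes-∷⁻ : ∀ {x : Fin n} {w a b} →
    Precedes (x ∷ w) a b → (x ≡ a × b ∈ w) ⊎ Precedes w a b
  Precedes-∷⁻ ([]    , v , refl , b∈v) = inj₁ (refl , b∈v)
  Precedes-∷⁻ (_ ∷ u , v , refl , b∈v) = inj₂ (u , v , refl , b∈v)

  Precedes-++⁺ˡ : ∀ {U V : Word n} {a b} → Precedes U a b → Precedes (U ++ V) a b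
  Precedes-++⁺ˡ {V = V} (u , v , refl , b∈v) =
    u , v ++ V , ++-assoc u (_ ∷ v) V , ∈-++⁺ˡ b∈v

  Precedes-++⁺ʳ : ∀ (U : Word n) {V a b} → Precedes V a b → Precedes (U ++ V) a b
  Precedes-++⁺ʳ []      p = p
  Precedes-++⁺ʳ (x ∷ U) p = Precedes-∷⁺ (Precedes-++⁺ʳ U p)

  Precedes-++⁺-∈ : ∀ {U V : Word n} {a b} → a ∈ U → b ∈ V → Precedes (U ++ V) a b
  Precedes-++⁺-∈ {V = V} a∈U b∈V with ∈-∃++ a∈U
  ... | u , v , refl = u , v ++ V , ++-assoc u (_ ∷ v) V , ∈-++⁺ʳ v b∈V

  Precedes-++⁻ : ∀ (U : Word n) {V a b} → Precedes (U ++ V) a b →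
    Precedes U a b ⊎ (a ∈ U × b ∈ V) ⊎ Precedes V a b
  Precedes-++⁻ []      p = inj₂ (inj₂ p)
  Precedes-++⁻ (x ∷ U) p with Precedes-∷⁻ p
  ... | inj₁ (refl , b∈UV) with ∈-++⁻ U b∈UV
  ...   | inj₁ b∈U = inj₁ (Precedes-head b∈U)
  ...   | inj₂ b∈V = inj₂ (inj₁ (here refl , b∈V))
  Precedes-++⁻ (x ∷ U) p | inj₂ q with Precedes-++⁻ U q
  ...   | inj₁ r                  = inj₁ (Precedes-∷⁺ r)
  ...   | inj₂ (inj₁ (a∈U , b∈V)) = inj₂ (inj₁ (there a∈U , b∈V))
  ...   | inj₂ (inj₂ r)           = inj₂ (inj₂ r)

  Precedes-swap : ∀ {x y : Fin n} {R a b} → Precedes (x ∷ y ∷ R) a b →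
    (x ≡ a × y ≡ b) ⊎ Precedes (y ∷ x ∷ R) a b
  Precedes-swap p with Precedes-∷⁻ p
  ... | inj₁ (refl , here refl) = inj₁ (refl , refl)
  ... | inj₁ (refl , there b∈R) = inj₂ (Precedes-∷⁺ (Precedes-head b∈R))
  ... | inj₂ q with Precedes-∷⁻ q
  ...   | inj₁ (refl , b∈R) = inj₂ (Precedes-head (there b∈R))
  ...   | inj₂ r            = inj₂ (Precedes-∷⁺ (Precedes-∷⁺ r))

  Precedes-dedup : ∀ {x : Fin n} {R a b} → Precedes (x ∷ x ∷ R) a b →
    (x ≡ a × x ≡ b) ⊎ Precedes (x ∷ R) a b
  Precedes-dedup p with Precedes-∷⁻ p
  ... | inj₁ (refl , here refl) = inj₁ (refl , refl)
  ... | inj₁ (refl , there b∈R) = inj₂ (Precedes-head b∈R)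
  ... | inj₂ q                  = inj₂ q

  Precedes-replace-suffix : ∀ (U : Word n) {s s' a b} → (∀ {x} → x ∈ s → x ∈ s') →
    (Precedes s a b → Precedes (U ++ s') a b) →
    Precedes (U ++ s) a b → Precedes (U ++ s') a b
  Precedes-replace-suffix U s⊆s' local p with Precedes-++⁻ U p
  ... | inj₁ q                  = Precedes-++⁺ˡ q
  ... | inj₂ (inj₁ (a∈U , b∈s)) = Precedes-++⁺-∈ a∈U (s⊆s' b∈s)
  ... | inj₂ (inj₂ q)          = local q

  Is12Rep-replace-suffix : ∀ (G : Graph n) (U : Word n) {s s' : Word n} →
    (∀ {x} → x ∈ s → x ∈ s') → (∀ {x} → x ∈ s' → x ∈ s) →
    (∀ {a b} → a < b → Precedes s a b → Precedes (U ++ s') a b) →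
    (∀ {a b} → a < b → Precedes s' a b → Precedes (U ++ s) a b) →
    Is12Rep G (U ++ s) → Is12Rep G (U ++ s')
  Is12Rep-replace-suffix G U {s} {s'} s⊆s' s'⊆s to from (covers , edges) = covers' , edges'
    where
    covers' : ∀ k → k ∈ U ++ s'
    covers' k with ∈-++⁻ U (covers k)
    ... | inj₁ k∈U = ∈-++⁺ˡ k∈U
    ... | inj₂ k∈s = ∈-++⁺ʳ U (s⊆s' k∈s)

    edges' : ∀ a b → a < b → Adj G a b ⇔ (¬ Precedes (U ++ s') a b)
    edges' a b a<b = mk⇔
      (λ adj p' → Equivalence.to (edges a b a<b) adj (Precedes-replace-suffix U s'⊆s (from a<b) p'))
      (λ ¬p' → Equivalence.from (edges a b a<b) (λ p → ¬p' (Precedes-replace-suffix U s⊆s' (to a<b) p)))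

  ∈-swap : ∀ {x y z : Fin n} {R} → x ∈ y ∷ z ∷ R → x ∈ z ∷ y ∷ R
  ∈-swap = ∈-resp-↭ (swap _ _ ↭-refl)

  Is12Rep-swap-descent-larger-after : ∀ (G : Graph n) (U : Word n) {i j R} →
    j < i → i ∈ R → Is12Rep G (U ++ i ∷ j ∷ R) → Is12Rep G (U ++ j ∷ i ∷ R)
  Is12Rep-swap-descent-larger-after G U {i} {j} {R} j<i i∈R =
    Is12Rep-replace-suffix G U ∈-swap ∈-swap to from
    where
    to : ∀ {a b} → a < b → Precedes (i ∷ j ∷ R) a b → Precedes (U ++ j ∷ i ∷ R) a b
    to a<b p with Precedes-swap p
    ... | inj₁ (refl , refl) = ⊥-elim (<-asym a<b j<i)
    ... | inj₂ q              = Precedes-++⁺ʳ U q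

    from : ∀ {a b} → a < b → Precedes (j ∷ i ∷ R) a b → Precedes (U ++ i ∷ j ∷ R) a b
    from _ p with Precedes-swap p
    ... | inj₁ (refl , refl) = Precedes-++⁺ʳ U (Precedes-∷⁺ (Precedes-head i∈R))
    ... | inj₂ q              = Precedes-++⁺ʳ U q

  Is12Rep-swap-descent-smaller-before : ∀ (G : Graph n) (U : Word n) {i j R} →
    i < j → i ∈ U → Is12Rep G (U ++ j ∷ i ∷ R) → Is12Rep G (U ++ i ∷ j ∷ R)
  Is12Rep-swap-descent-smaller-before G U {i} {j} {R} i<j i∈U =
    Is12Rep-replace-suffix G U ∈-swap ∈-swap to from
    where
    to : ∀ {a b} → a < b → Precedes (j ∷ i ∷ R) a b → Precedes (U ++ i ∷ j ∷ R) a b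
    to a<b p with Precedes-swap p
    ... | inj₁ (refl , refl) = ⊥-elim (<-asym a<b i<j)
    ... | inj₂ q              = Precedes-++⁺ʳ U q

    from : ∀ {a b} → a < b → Precedes (i ∷ j ∷ R) a b → Precedes (U ++ j ∷ i ∷ R) a b
    from _ p with Precedes-swap p
    ... | inj₁ (refl , refl) = Precedes-++⁺-∈ i∈U (here refl)
    ... | inj₂ q              = Precedes-++⁺ʳ U q

  Is12Rep-dedup : ∀ (G : Graph n) (U : Word n) {x R} →
    Is12Rep G (U ++ x ∷ x ∷ R) → Is12Rep G (U ++ x ∷ R)
  Is12Rep-dedup G U {x} {R} = Is12Rep-replace-suffix G U merge there to from
    where
    merge : ∀ {y} → y ∈ x ∷ x ∷ R → y ∈ x ∷ R
    merge (here y≡x) = here y≡x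
    merge (there y∈) = y∈

    to : ∀ {a b} → a < b → Precedes (x ∷ x ∷ R) a b → Precedes (U ++ x ∷ R) a b
    to a<b p with Precedes-dedup p
    ... | inj₁ (refl , refl) = ⊥-elim (<-irrefl refl a<b)
    ... | inj₂ q              = Precedes-++⁺ʳ U q

    from : ∀ {a b} → a < b → Precedes (x ∷ R) a b → Precedes (U ++ x ∷ x ∷ R) a b
    from _ p = Precedes-++⁺ʳ U (Precedes-∷⁺ p)

proposition3p4 : ∀ {n} (G : Graph n) (w : Word n) (i : Fin n) →
    Is12Rep G w → occ i w ≡ 2 →
    (∀ (W₁ W₂ W₃ : Word n) (j : Fin n) → j < i →
       w ≡ W₁ ++ (i ∷ j ∷ W₂) ++ (i ∷ W₃) →
       Is12Rep G (W₁ ++ (j ∷ i ∷ W₂) ++ (i ∷ W₃)))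
    ×
    (∀ (W₁ W₂ W₃ : Word n) (j : Fin n) → j > i →
       w ≡ W₁ ++ (i ∷ W₂) ++ (j ∷ i ∷ W₃) →
       Is12Rep G (W₁ ++ (i ∷ W₂) ++ (i ∷ j ∷ W₃)))
    ×
    (∀ (W₁ W₂ : Word n) →
       w ≡ W₁ ++ (i ∷ i ∷ W₂) →
       Is12Rep G (W₁ ++ (i ∷ W₂)))
proposition3p4 G w i rep _ =
  (λ { W₁ W₂ W₃ j j<i refl →
         Is12Rep-swap-descent-larger-after G W₁ j<i (∈-++⁺ʳ W₂ (here refl)) rep })
  ,
  (λ { W₁ W₂ W₃ j i<j refl →
         subst (Is12Rep G) (++-assoc W₁ (i ∷ W₂) (i ∷ j ∷ W₃))
           (Is12Rep-swap-descent-smaller-before G (W₁ ++ i ∷ W₂) i<j (∈-++⁺ʳ W₁ (here refl))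
             (subst (Is12Rep G) (≡.sym (++-assoc W₁ (i ∷ W₂) (j ∷ i ∷ W₃))) rep)) })
  ,
  (λ { W₁ W₂ refl → Is12Rep-dedup G W₁ rep })
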